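{- (In ZF, i.e. without the Axiom of Choice.) Let $A$, $B_1$, $B_2$, $B_3$ be sets such that $A \ll B_1 + B_2 + B_3$. Then there are pairwise disjoint sets $A_1, A_2, A_3$ with $A = A_1 \cup A_2 \cup A_3$ such that $A_1 \ll B_1$, $A_2 \ll B_2$ and $A_3 \ll B_3$.
   Context: All reasoning takes place in ZF without the Axiom of Choice. For sets $X,Y$, $X+Y$ denotes the disjoint union $(\{0\}\times X)\cup(\{1\}\times Y)$, and $B_1+B_2+B_3$ denotes the disjoint union of the three sets (e.g. $\bigcup_{i=1}^3 \{i\}\times B_i$). We write $X \ll Z$ (equivalently $Z \gg X$, "$Z$ swallows $X$") if there is a bijection between $Z+X$ and $Z$. -}

module Defs where

open import Level using (0ℓ)
open import Data.Sum using (_⊎_)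
open import Data.Product using (Σ; _×_)
open import Data.Empty using (⊥)
open import Function.Bundles using (_↔_)
open import Relation.Nullary using (Dec; ¬_; Irrelevant)

-- "Sets" of ZF are modelled as types in Set (= Set₀).

_≪_ : Set → Set → Set
X ≪ Z = (Z ⊎ X) ↔ Z

infix 4 _≪_

-- The ambient logic of ZF is classical: excluded middle for propositions
-- (types with at most one element). NOT for arbitrary types, since that
-- would yield a form of global choice.
PropLEM : Set₁
PropLEM = (P : Set) → Irrelevant P → Dec P

IsSubset : {A : Set} → (A → Set) → Set
IsSubset {A} S = (a : A) → Irrelevant (S a)

⟦_⟧ : {A : Set} → (A → Set) → Set
⟦_⟧ {A} S = Σ A S

IsPartition3 : {A : Set} → (A → Set) → (A → Set) → (A → Set) → Set
IsPartition3 {A} A₁ A₂ A₃ =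
  IsSubset A₁ × IsSubset A₂ × IsSubset A₃ ×
  ((a : A) → ¬ (A₁ a × A₂ a)) ×
  ((a : A) → ¬ (A₁ a × A₃ a)) ×
  ((a : A) → ¬ (A₂ a × A₃ a)) ×
  ((a : A) → A₁ a ⊎ A₂ a ⊎ A₃ a)

-- Iterating the injection Z + A → Z from a ∈ A gives an injective orbit
-- ℕ × A → Z, where Z = B + C. Excluded middle decides, for each a, whether the
-- orbit of a visits B infinitely often; if not, it visits C infinitely often.
-- On either side, sending (k, a) to the k-th visit of the orbit of a embeds ℕ × Aᵢ
-- into the corresponding summand, with complemented image by excluded middle, and
-- Hilbert's hotel inside that copy of ℕ × Aᵢ swallows Aᵢ. Two binary splits give
-- the ternary one. No choice is involved: excluded middle only decides
-- propositions, so the next visit is always taken to be the least one.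
module Submission where

open import Defs
open import Data.Sum using (_⊎_)
open import Data.Product using (Σ-syntax; _×_)

open import Axiom.UniquenessOfIdentityProofs.WithK using (uip)
open import Data.Bool using (Bool; true; false; not; T)
open import Data.Bool.Properties using (T-irrelevant)
open import Data.Empty using (⊥-elim)
open import Data.Nat using (ℕ; zero; suc; _+_; _∸_; _≤_; _<_)
open import Data.Nat.Properties
  using (≤-refl; <⇒≤; <-trans; <-≤-trans; <-irrefl; <-cmp; ≤-irrelevant; +-suc;
         m∸n+n≡m; m≤n⇒m<n∨m≡n; m<1+n⇒m<n∨m≡n; m≤m⊔n; m≤n⊔m)
open import Data.Product using (Σ; ∃-syntax; _,_; proj₁; proj₂)
open import Data.Product.Properties using (,-injectiveˡ; ,-injectiveʳ)
open import Data.Sum using (inj₁; inj₂; swap)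
open import Data.Sum.Function.Propositional using (_⊎-↔_)
open import Data.Sum.Properties using (inj₁-injective; inj₂-injective; swap-involutive)
open import Function using (_∘_)
open import Function.Bundles using (_↔_; mk↔ₛ′; Inverse; Injection)
open import Function.Definitions using (Injective)
open import Function.Properties.Inverse using (↔-refl; ↔-sym; ↔-trans; ↔⇒↣)
open import Function.Related.TypeIsomorphisms using (⊎-assoc; Σ-assoc)
open import Relation.Binary.Definitions using (tri<; tri≈; tri>)
open import Relation.Binary.PropositionalEquality
open import Relation.Nullary using (Dec; yes; no; does; ¬_; Irrelevant)

T-not⇒¬T : ∀ {b} → T (not b) → ¬ T b
T-not⇒¬T {false} _ ()

¬T⇒T-not : ∀ {b} → ¬ T b → T (not b)
¬T⇒T-not {true}  ¬t = ¬t _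
¬T⇒T-not {false} _  = _

T⊎T-not : ∀ b → T b ⊎ T (not b)
T⊎T-not true  = inj₁ _
T⊎T-not false = inj₂ _

≪-respˡ-↔ : {X Y Z : Set} → X ↔ Y → X ≪ Z → Y ≪ Z
≪-respˡ-↔ X↔Y X≪Z = ↔-trans (↔-refl ⊎-↔ ↔-sym X↔Y) X≪Z

≪-respʳ-↔ : {X Y Z : Set} → X ≪ Y → Y ↔ Z → X ≪ Z
≪-respʳ-↔ X≪Y Y↔Z = ↔-trans (↔-trans (↔-sym Y↔Z ⊎-↔ ↔-refl) X≪Y) Y↔Z

≪-⊎ˡ : {X Y C : Set} → X ≪ Y → X ≪ (C ⊎ Y)
≪-⊎ˡ X≪Y = ↔-trans (⊎-assoc _ _ _ _) (↔-refl ⊎-↔ X≪Y)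

≪-ℕ× : {X : Set} → X ≪ (ℕ × X)
≪-ℕ× {X} = mk↔ₛ′ shift unshift shift∘unshift unshift∘shift
  where
  shift : (ℕ × X) ⊎ X → ℕ × X
  shift (inj₁ (n , x)) = suc n , x
  shift (inj₂ x)       = zero , x

  unshift : ℕ × X → (ℕ × X) ⊎ X
  unshift (zero  , x) = inj₂ x
  unshift (suc n , x) = inj₁ (n , x)

  shift∘unshift : ∀ w → shift (unshift w) ≡ w
  shift∘unshift (zero  , x) = refl
  shift∘unshift (suc n , x) = refl

  unshift∘shift : ∀ w → unshift (shift w) ≡ w
  unshift∘shift (inj₁ _) = refl
  unshift∘shift (inj₂ _) = refl

Image : {Y Z : Set} → (Y → Z) → Z → Set
Image h z = ∃[ y ] h y ≡ z

module _ {Y Z : Set} (h : Y → Z) (h-injective : Injective _≡_ _≡_ h) where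

  image-irrelevant : ∀ z → Irrelevant (Image h z)
  image-irrelevant z (y , p) (y′ , p′) with h-injective (trans p (sym p′))
  ... | refl = cong (y ,_) (uip p p′)

  complement⊎image : (∀ z → Dec (Image h z)) → Z ↔ (Σ Z (¬_ ∘ Image h) ⊎ Y)
  complement⊎image image? = mk↔ₛ′ (λ z → split z (image? z)) join split∘join join∘split
    where
    split : (z : Z) → Dec (Image h z) → Σ Z (¬_ ∘ Image h) ⊎ Y
    split z (yes (y , _)) = inj₂ y
    split z (no ∉image)   = inj₁ (z , ∉image)

    join : Σ Z (¬_ ∘ Image h) ⊎ Y → Z
    join (inj₁ (z , _)) = z
    join (inj₂ y)       = h y

    split∘join : ∀ w → split (join w) (image? (join w)) ≡ w
    split∘join (inj₁ (z , ∉image)) with image? z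
    ... | yes ∈image = ⊥-elim (∉image ∈image)
    ... | no _       = refl
    split∘join (inj₂ y) with image? (h y)
    ... | yes (y′ , p) = cong inj₂ (h-injective p)
    ... | no ∉image    = ⊥-elim (∉image (y , refl))

    join∘split : ∀ z → join (split z (image? z)) ≡ z
    join∘split z with image? z
    ... | yes (_ , p) = p
    ... | no _        = refl

≪-fromInjection : PropLEM → {X Z : Set} (h : ℕ × X → Z) → Injective _≡_ _≡_ h → X ≪ Z
≪-fromInjection lem h h-injective =
  ≪-respʳ-↔ (≪-⊎ˡ ≪-ℕ×)
    (↔-sym (complement⊎image h h-injective
      (λ z → lem (Image h z) (image-irrelevant h h-injective z))))

module _ {X Z : Set} (X≪Z : X ≪ Z) where

  private
    to-injective : Injective _≡_ _≡_ (Inverse.to X≪Z)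
    to-injective = Injection.injective (↔⇒↣ X≪Z)

  orbit : ℕ × X → Z
  orbit (zero  , x) = Inverse.to X≪Z (inj₂ x)
  orbit (suc n , x) = Inverse.to X≪Z (inj₁ (orbit (n , x)))

  orbit-injective : Injective _≡_ _≡_ orbit
  orbit-injective {zero , x} {zero , y} eq = cong (zero ,_) (inj₂-injective (to-injective eq))
  orbit-injective {zero , x} {suc m , y} eq with to-injective eq
  ... | ()
  orbit-injective {suc n , x} {zero , y} eq with to-injective eq
  ... | ()
  orbit-injective {suc n , x} {suc m , y} eq
    with orbit-injective {n , x} {m , y} (inj₁-injective (to-injective eq))
  ... | refl = refl

-- Stated negatively so that it is a proposition: ⊥ is definitionally proof-irrelevant.
InfinitelyOften : (ℕ → Bool) → Set
InfinitelyOften p = ¬ (∃[ m ] ∀ {n} → m ≤ n → ¬ T (p n))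

infinitelyOften-irrelevant : ∀ p → Irrelevant (InfinitelyOften p)
infinitelyOften-irrelevant p _ _ = refl

infinitelyOften-resp : ∀ {p q} → (∀ n → p n ≡ q n) → InfinitelyOften p → InfinitelyOften q
infinitelyOften-resp p≗q io (m , never) = io (m , λ {n} m≤n → never m≤n ∘ subst T (p≗q n))

infinitelyOften-not : ∀ {p} → ¬ InfinitelyOften p → InfinitelyOften (not ∘ p)
infinitelyOften-not ¬io (m′ , never-not) = ¬io λ (m , never) →
  never-not (m≤n⊔m m m′) (¬T⇒T-not (never (m≤m⊔n m m′)))

module _ (p : ℕ → Bool) where

  FirstFrom : ℕ → Set
  FirstFrom m = ∃[ n ] m ≤ n × T (p n) × (∀ {k} → m ≤ k → k < n → ¬ T (p k))

  firstFrom-irrelevant : ∀ m → Irrelevant (FirstFrom m)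
  firstFrom-irrelevant m (n , m≤n , t , before) (n′ , m≤n′ , t′ , before′) with <-cmp n n′
  ... | tri< n<n′ _ _ = ⊥-elim (before′ m≤n n<n′ t)
  ... | tri> _ _ n′<n = ⊥-elim (before m≤n′ n′<n t′)
  ... | tri≈ _ refl _ =
    cong₂ (λ m≤n t → n , m≤n , t , λ {k} → before {k}) (≤-irrelevant m≤n m≤n′) (T-irrelevant t t′)

  firstFrom-witness : ∀ {m n} → m ≤ n → T (p n) → FirstFrom m
  firstFrom-witness {m} {n} m≤n t = search (n ∸ m) m (subst (T ∘ p) (sym (m∸n+n≡m m≤n)) t)
    where
    search : ∀ d m → T (p (d + m)) → FirstFrom m
    search d m t with T⊎T-not (p m)
    ... | inj₁ tₘ = m , ≤-refl , tₘ , λ m≤k k<m → ⊥-elim (<-irrefl refl (<-≤-trans k<m m≤k))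
    search zero    m t | inj₂ ¬tₘ = ⊥-elim (T-not⇒¬T ¬tₘ t)
    search (suc d) m t | inj₂ ¬tₘ with search d (suc m) (subst (T ∘ p) (sym (+-suc d m)) t)
    ... | n , m<n , tₙ , before = n , <⇒≤ m<n , tₙ , before′
      where
      before′ : ∀ {k} → m ≤ k → k < n → ¬ T (p k)
      before′ m≤k k<n with m≤n⇒m<n∨m≡n m≤k
      ... | inj₁ m<k  = before m<k k<n
      ... | inj₂ refl = T-not⇒¬T ¬tₘ

  firstFrom : PropLEM → InfinitelyOften p → ∀ m → FirstFrom m
  firstFrom lem io m with lem (FirstFrom m) (firstFrom-irrelevant m)
  ... | yes first = first
  ... | no ¬first = ⊥-elim (io (m , λ m≤n t → ¬first (firstFrom-witness m≤n t)))

  nextOccurrence : PropLEM → InfinitelyOften p → ∀ m → ∃[ n ] m ≤ n × T (p n)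
  nextOccurrence lem io m with firstFrom lem io m
  ... | n , m≤n , t , _ = n , m≤n , t

module Enumeration {P : ℕ → Set} (next : ∀ m → ∃[ n ] m ≤ n × P n) where

  nth : ℕ → ℕ
  nth zero    = proj₁ (next zero)
  nth (suc k) = proj₁ (next (suc (nth k)))

  nth-satisfies : ∀ k → P (nth k)
  nth-satisfies zero    = proj₂ (proj₂ (next zero))
  nth-satisfies (suc k) = proj₂ (proj₂ (next (suc (nth k))))

  nth<nth-suc : ∀ k → nth k < nth (suc k)
  nth<nth-suc k = proj₁ (proj₂ (next (suc (nth k))))

  nth-strictlyIncreasing : ∀ {j k} → j < k → nth j < nth k
  nth-strictlyIncreasing {j} {suc k} j<1+k with m<1+n⇒m<n∨m≡n j<1+k
  ... | inj₁ j<k  = <-trans (nth-strictlyIncreasing j<k) (nth<nth-suc k)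
  ... | inj₂ refl = nth<nth-suc k

  nth-injective : Injective _≡_ _≡_ nth
  nth-injective {j} {k} eq with <-cmp j k
  ... | tri< j<k _ _ = ⊥-elim (<-irrefl eq (nth-strictlyIncreasing j<k))
  ... | tri≈ _ j≡k _ = j≡k
  ... | tri> _ _ k<j = ⊥-elim (<-irrefl (sym eq) (nth-strictlyIncreasing k<j))

isLeft : {B C : Set} → B ⊎ C → Bool
isLeft (inj₁ _) = true
isLeft (inj₂ _) = false

isLeft-swap : {B C : Set} (x : B ⊎ C) → isLeft (swap x) ≡ not (isLeft x)
isLeft-swap (inj₁ _) = refl
isLeft-swap (inj₂ _) = refl

fromLeft : {B C : Set} (x : B ⊎ C) → T (isLeft x) → B
fromLeft (inj₁ b) _ = b

fromLeft-injective : {B C : Set} {x y : B ⊎ C} (s : T (isLeft x)) (t : T (isLeft y)) →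
                     fromLeft x s ≡ fromLeft y t → x ≡ y
fromLeft-injective {x = inj₁ _} {inj₁ _} _ _ eq = cong inj₁ eq

swap-injective : {B C : Set} → Injective _≡_ _≡_ (swap {A = B} {B = C})
swap-injective {x = x} {y} eq =
  trans (sym (swap-involutive x)) (trans (cong swap eq) (swap-involutive y))

leftAt : {A B C : Set} → (ℕ × A → B ⊎ C) → A → ℕ → Bool
leftAt o a n = isLeft (o (n , a))

module _ (lem : PropLEM) {A B C : Set} (o : ℕ × A → B ⊎ C) (o-injective : Injective _≡_ _≡_ o) where

  ≪-ofRecurrentLeft : (S : A → Set) → IsSubset S → (∀ a → S a → InfinitelyOften (leftAt o a)) →
                      ⟦ S ⟧ ≪ B
  ≪-ofRecurrentLeft S S-irrelevant recurrent = ≪-fromInjection lem h h-injective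
    where
    nextVisit : (x : ⟦ S ⟧) → ∀ m → ∃[ n ] m ≤ n × T (leftAt o (proj₁ x) n)
    nextVisit (a , s) = nextOccurrence (leftAt o a) lem (recurrent a s)

    open module Visits (x : ⟦ S ⟧) = Enumeration (nextVisit x)
      using () renaming (nth to visit; nth-satisfies to visit-left; nth-injective to visit-injective)

    h : ℕ × ⟦ S ⟧ → B
    h (k , a , s) = fromLeft (o (visit (a , s) k , a)) (visit-left (a , s) k)

    h-injective : Injective _≡_ _≡_ h
    h-injective {k , a , s} {k′ , a′ , s′} eq with o-injective (fromLeft-injective _ _ eq)
    ... | eq′ with ,-injectiveʳ eq′
    ... | refl with S-irrelevant a s s′
    ... | refl = cong (λ k → k , a , s) (visit-injective (a , s) (,-injectiveˡ eq′))

≪-split : PropLEM → {A B C : Set} → A ≪ (B ⊎ C) →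
          Σ[ χ ∈ (A → Bool) ] ⟦ T ∘ χ ⟧ ≪ B × ⟦ T ∘ not ∘ χ ⟧ ≪ C
≪-split lem {A} {B} {C} A≪B⊎C =
    χ
  , ≪-ofRecurrentLeft lem o o-injective (T ∘ χ) (λ _ → T-irrelevant) recurrentˡ
  , ≪-ofRecurrentLeft lem (swap ∘ o) (o-injective ∘ swap-injective) (T ∘ not ∘ χ)
      (λ _ → T-irrelevant) recurrentʳ
  where
  o : ℕ × A → B ⊎ C
  o = orbit A≪B⊎C

  o-injective : Injective _≡_ _≡_ o
  o-injective = orbit-injective A≪B⊎C

  recurrent? : ∀ a → Dec (InfinitelyOften (leftAt o a))
  recurrent? a = lem _ (infinitelyOften-irrelevant _)

  χ : A → Bool
  χ a = does (recurrent? a)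

  recurrentˡ : ∀ a → T (χ a) → InfinitelyOften (leftAt o a)
  recurrentˡ a t with recurrent? a
  ... | yes io = io

  recurrentʳ : ∀ a → T (not (χ a)) → InfinitelyOften (leftAt (swap ∘ o) a)
  recurrentʳ a t with recurrent? a
  ... | no ¬io = infinitelyOften-resp (λ n → sym (isLeft-swap (o (n , a)))) (infinitelyOften-not ¬io)

Within : {A : Set} (U : A → Set) → (⟦ U ⟧ → Set) → A → Set
Within U S a = Σ (U a) λ u → S (a , u)

within-isSubset : {A : Set} {U : A → Set} {S : ⟦ U ⟧ → Set} →
                  IsSubset U → IsSubset S → IsSubset (Within U S)
within-isSubset U-irrelevant S-irrelevant a (u , s) (u′ , s′) with U-irrelevant a u u′
... | refl = cong (u ,_) (S-irrelevant (a , u) s s′)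

isPartition3-twoSplits : {A : Set} (χ₁ : A → Bool) (χ₂ : ⟦ T ∘ not ∘ χ₁ ⟧ → Bool) →
  IsPartition3 (T ∘ χ₁) (Within (T ∘ not ∘ χ₁) (T ∘ χ₂)) (Within (T ∘ not ∘ χ₁) (T ∘ not ∘ χ₂))
isPartition3-twoSplits χ₁ χ₂ =
    (λ _ → T-irrelevant)
  , within-isSubset (λ _ → T-irrelevant) (λ _ → T-irrelevant)
  , within-isSubset (λ _ → T-irrelevant) (λ _ → T-irrelevant)
  , (λ a (t , t′ , _) → T-not⇒¬T t′ t)
  , (λ a (t , t′ , _) → T-not⇒¬T t′ t)
  , (λ a ((t , u) , (t′ , u′)) → T-not⇒¬T u′ (subst (T ∘ χ₂ ∘ (a ,_)) (T-irrelevant t t′) u))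
  , cover
  where
  cover : ∀ a → T (χ₁ a) ⊎ Within (T ∘ not ∘ χ₁) (T ∘ χ₂) a ⊎ Within (T ∘ not ∘ χ₁) (T ∘ not ∘ χ₂) a
  cover a with T⊎T-not (χ₁ a)
  ... | inj₁ t = inj₁ t
  ... | inj₂ t with T⊎T-not (χ₂ (a , t))
  ...   | inj₁ u = inj₂ (inj₁ (t , u))
  ...   | inj₂ u = inj₂ (inj₂ (t , u))

lemma2 : PropLEM →
    (A B₁ B₂ B₃ : Set) → A ≪ (B₁ ⊎ B₂ ⊎ B₃) →
    Σ[ A₁ ∈ (A → Set) ] Σ[ A₂ ∈ (A → Set) ] Σ[ A₃ ∈ (A → Set) ]
    (IsPartition3 A₁ A₂ A₃ × ⟦ A₁ ⟧ ≪ B₁ × ⟦ A₂ ⟧ ≪ B₂ × ⟦ A₃ ⟧ ≪ B₃)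
lemma2 lem A B₁ B₂ B₃ A≪B with ≪-split lem A≪B
... | χ₁ , A₁≪B₁ , A′≪B₂⊎B₃ with ≪-split lem A′≪B₂⊎B₃
... | χ₂ , A₂≪B₂ , A₃≪B₃ =
    T ∘ χ₁ , Within (T ∘ not ∘ χ₁) (T ∘ χ₂) , Within (T ∘ not ∘ χ₁) (T ∘ not ∘ χ₂)
  , isPartition3-twoSplits χ₁ χ₂
  , A₁≪B₁ , ≪-respˡ-↔ Σ-assoc A₂≪B₂ , ≪-respˡ-↔ Σ-assoc A₃≪B₃
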